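{- For every DT formula $A$, the sequent ${\mathrm{Cls}}(A)\to{\mathrm{Tms}}(A)$ has a tree-like ${\mathrm{LK}}$ proof in which every cut formula is atomic (a literal), of size polynomial in the size of $A$, and also a (dag-like) cut-free ${\mathrm{LK}}$ proof of size polynomial in the size of $A$.
   Context: A literal is a propositional variable $x$ or its negation $\overline x$. DT formulas: literals, and $(ApB)$ for DT formulas $A,B$ and literal $p$ ("if $p$ is false then $A$, else $B$"). ${\mathrm{Tms}}(p)={\mathrm{Cls}}(p)=\{p\}$; ${\mathrm{Tms}}(BpC)=\{\overline p\land D:D\in{\mathrm{Tms}}(B)\}\cup\{p\land D:D\in{\mathrm{Tms}}(C)\}$; ${\mathrm{Cls}}(BpC)=\{p\lor D:D\in{\mathrm{Cls}}(B)\}\cup\{\overline p\lor D:D\in{\mathrm{Cls}}(C)\}$, with conjunctions and disjunctions associated right to left; in a sequent these multisets denote cedents. ${\mathrm{LK}}$ is the usual sequent calculus for Boolean formulas built from literals by binary $\land,\lor$: initial sequents $p\to p$, $p,\overline p\to$, $\to p,\overline p$; contraction, weakening, cut, and the standard left/right introduction rules for $\land$ and $\lor$. Proofs are dag-like unless tree-like (each sequent used at most once as a premise) is specified. -}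

module Defs where

open import Data.Nat using (ℕ; zero; suc; _+_; _<_)
open import Data.Bool using (Bool; not)
open import Data.List using (List; []; _∷_; _++_; [_]; map; concatMap; last)
open import Data.Nat.ListAction using (sum)
open import Data.Maybe using (Maybe; just; nothing)
open import Data.Product using (Σ; _×_; _,_; proj₁; proj₂)
open import Data.Unit using (⊤)
open import Data.Empty using (⊥)
open import Data.List.Relation.Binary.Permutation.Propositional using (_↭_)
open import Data.List.Relation.Binary.Pointwise using (Pointwise)
open import Data.List.Relation.Unary.Unique.Propositional using (Unique)
open import Relation.Binary.PropositionalEquality using (_≡_)

-- Literals: a variable x (pos = true) or its negation x̄ (pos = false)

record Lit : Set where
  constructor lit
  field
    var : ℕ
    pos : Bool

neg : Lit → Lit
neg (lit x b) = lit x (not b)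

infixr 8 _∧_
infixr 7 _∨_

data Fm : Set where
  atom : Lit → Fm
  _∧_  : Fm → Fm → Fm
  _∨_  : Fm → Fm → Fm

fmSize : Fm → ℕ
fmSize (atom p) = 1
fmSize (A ∧ B)  = suc (fmSize A + fmSize B)
fmSize (A ∨ B)  = suc (fmSize A + fmSize B)

-- DT formulas: (node A p B) is (ApB): "if p is false then A, else B"

data DT : Set where
  leaf : Lit → DT
  node : DT → Lit → DT → DT

dtSize : DT → ℕ
dtSize (leaf p)     = 1
dtSize (node A p B) = suc (dtSize A + dtSize B)

-- Tms and Cls, as lists (cedents); conjunction/disjunction associated
-- right to left:  p̄ ∧ D  with D itself already built.
Tms : DT → List Fm
Tms (leaf p)     = [ atom p ]
Tms (node B p C) = map (λ D → atom (neg p) ∧ D) (Tms B)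
                ++ map (λ D → atom p ∧ D) (Tms C)

Cls : DT → List Fm
Cls (leaf p)     = [ atom p ]
Cls (node B p C) = map (λ D → atom p ∨ D) (Cls B)
                ++ map (λ D → atom (neg p) ∨ D) (Cls C)

-- Sequents; cedents are multisets, i.e. lists up to permutation

infix 3 _⇒_
record Seq : Set where
  constructor _⇒_
  field
    ant : List Fm
    succ : List Fm

_≈S_ : Seq → Seq → Set
(Γ ⇒ Δ) ≈S (Γ' ⇒ Δ') = (Γ ↭ Γ') × (Δ ↭ Δ')

-- number of symbols of a sequent (the arrow counts as one symbol)
seqSize : Seq → ℕ
seqSize (Γ ⇒ Δ) = suc (sum (map fmSize Γ) + sum (map fmSize Δ))

-- LK inferences (Buss-style, shared contexts), principal formulas in front.
-- Inf ps s : s follows from the premises ps by one LK rule.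

data Inf : List Seq → Seq → Set where
  ax     : ∀ p → Inf [] ([ atom p ] ⇒ [ atom p ])
  axL    : ∀ p → Inf [] (atom p ∷ atom (neg p) ∷ [] ⇒ [])
  axR    : ∀ p → Inf [] ([] ⇒ atom p ∷ atom (neg p) ∷ [])
  contrL : ∀ {Γ Δ} A → Inf [ A ∷ A ∷ Γ ⇒ Δ ] (A ∷ Γ ⇒ Δ)
  contrR : ∀ {Γ Δ} A → Inf [ Γ ⇒ A ∷ A ∷ Δ ] (Γ ⇒ A ∷ Δ)
  weakL  : ∀ {Γ Δ} A → Inf [ Γ ⇒ Δ ] (A ∷ Γ ⇒ Δ)
  weakR  : ∀ {Γ Δ} A → Inf [ Γ ⇒ Δ ] (Γ ⇒ A ∷ Δ)
  cut    : ∀ {Γ Δ} A → Inf ((Γ ⇒ A ∷ Δ) ∷ (A ∷ Γ ⇒ Δ) ∷ []) (Γ ⇒ Δ)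
  ∧L₁    : ∀ {Γ Δ} A B → Inf [ A ∷ Γ ⇒ Δ ] (A ∧ B ∷ Γ ⇒ Δ)
  ∧L₂    : ∀ {Γ Δ} A B → Inf [ B ∷ Γ ⇒ Δ ] (A ∧ B ∷ Γ ⇒ Δ)
  ∧R     : ∀ {Γ Δ} A B → Inf ((Γ ⇒ A ∷ Δ) ∷ (Γ ⇒ B ∷ Δ) ∷ []) (Γ ⇒ A ∧ B ∷ Δ)
  ∨L     : ∀ {Γ Δ} A B → Inf ((A ∷ Γ ⇒ Δ) ∷ (B ∷ Γ ⇒ Δ) ∷ []) (A ∨ B ∷ Γ ⇒ Δ)
  ∨R₁    : ∀ {Γ Δ} A B → Inf [ Γ ⇒ A ∷ Δ ] (Γ ⇒ A ∨ B ∷ Δ)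
  ∨R₂    : ∀ {Γ Δ} A B → Inf [ Γ ⇒ B ∷ Δ ] (Γ ⇒ A ∨ B ∷ Δ)

isAtom : Fm → Set
isAtom (atom _) = ⊤
isAtom (_ ∧ _)  = ⊥
isAtom (_ ∨ _)  = ⊥

CutFree : ∀ {ps s} → Inf ps s → Set
CutFree (cut _) = ⊥
CutFree _       = ⊤

AtomicCut : ∀ {ps s} → Inf ps s → Set
AtomicCut (cut A) = isAtom A
AtomicCut _       = ⊤

System : Set₁
System = ∀ {ps s} → Inf ps s → Set

Step : System → List Seq → Seq → Set
Step ok ps s = Σ (List Seq) λ ps' → Σ Seq λ s' →
  Pointwise _≈S_ ps ps' × s ≈S s' × Σ (Inf ps' s') λ r → ok r

-- (dag-like) proofs: a list of lines; each line is a sequent together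
-- with the list of indices (0-based, into the list of lines) of its
-- premises, which must be earlier lines.

Line : Set
Line = Seq × List ℕ

nth : List Seq → ℕ → Maybe Seq
nth []       _       = nothing
nth (s ∷ ss) zero    = just s
nth (s ∷ ss) (suc i) = nth ss i

ValidFrom : System → List Seq → List Line → Set
ValidFrom ok prev []              = ⊤
ValidFrom ok prev ((s , is) ∷ ls) =
  (Σ (List Seq) λ ps → Pointwise (λ i p → nth prev i ≡ just p) is ps × Step ok ps s)
  × ValidFrom ok (prev ++ [ s ]) ls

IsProof : System → List Line → Seq → Set
IsProof ok P S = ValidFrom ok [] P × last (map (λ l → proj₁ l) P) ≡ just S

-- tree-like: every line is used at most once as a premise
TreeLike : List Line → Set
TreeLike P = Unique (concatMap (λ l → proj₂ l) P)

proofSize : List Line → ℕ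
proofSize P = sum (map (λ l → seqSize (proj₁ l)) P)

-- For A = (B p C), splitting every clause p ∨ D of p ∨ Cls B by ∨L and every term p̄ ∧ E of p̄ ∧ Tms B by ∧R,
-- with weakened axioms as the side premises, turns Cls B ⇒ Tms B into p ∨ Cls B ⇒ p, p̄ ∧ Tms B and into
-- p̄, p ∨ Cls B ⇒ p̄ ∧ Tms B, using O(n²) inferences.  After weakening, one cut on p combines the first of these
-- with the symmetric sequent obtained from C, giving a tree-like proof of size polynomial in n = dtSize A.
-- Without cut, both guarded sequents of B are derived once and then reused for every clause p̄ ∨ D of the
-- else-branch (∨L) and every term p ∧ E (∧R), which makes the proof dag-like.  Sizes are controlled through
-- inference counts: apart from atomic cuts, which add one symbol, no inference used has a premise larger
-- than its conclusion.

module Submission where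

open import Defs
open import Data.Bool.Properties using (not-involutive)
open import Data.Empty using (⊥)
open import Data.List using (List; []; _∷_; _++_; [_]; map; length; concatMap; last)
open import Data.List.Properties using (++-assoc; ++-identityʳ; map-++; length-++; length-map; concatMap-++)
open import Data.List.Relation.Binary.Permutation.Propositional
  using (_↭_; ↭-refl; ↭-sym; ↭-trans; ↭⇒↭ₛ; module PermutationReasoning)
import Data.List.Relation.Binary.Permutation.Propositional.Properties as ↭
open import Data.List.Relation.Binary.Pointwise using (Pointwise; []; _∷_)
import Data.List.Relation.Binary.Pointwise.Properties as Pointwise
open import Data.List.Relation.Unary.All using (All; []; _∷_)
import Data.List.Relation.Unary.All as All
import Data.List.Relation.Unary.All.Properties as AllP
open import Data.List.Relation.Unary.AllPairs using ([]; _∷_)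
import Data.List.Relation.Unary.AllPairs.Properties as AllPairs
open import Data.List.Relation.Unary.Unique.Propositional using (Unique)
open import Data.Maybe using (just)
open import Data.Nat using (ℕ; zero; suc; _+_; _*_; _^_; _≤_; _<_; z≤n; s≤s)
open import Data.Nat.ListAction using (sum)
open import Data.Nat.ListAction.Properties using (sum-++; sum-↭)
open import Data.Nat.Properties
open import Data.Nat.Tactic.RingSolver using (solve-∀)
open import Data.Product using (Σ; _×_; _,_; proj₁; proj₂)
open import Data.Unit using (⊤; tt)
open import Relation.Binary.PropositionalEquality
  using (_≡_; _≢_; refl; sym; trans; cong; cong₂; subst; subst₂; setoid; module ≡-Reasoning)
open import Relation.Nullary using (contradiction)
open import Data.List.Relation.Binary.Permutation.Setoid.Properties (setoid ℕ) using (Unique-resp-↭)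

cedentSize : List Fm → ℕ
cedentSize Γ = sum (map fmSize Γ)

cedentSize-++ : ∀ Γ Δ → cedentSize (Γ ++ Δ) ≡ cedentSize Γ + cedentSize Δ
cedentSize-++ Γ Δ = trans (cong sum (map-++ fmSize Γ Δ)) (sum-++ (map fmSize Γ) (map fmSize Δ))

cedentSize-↭ : ∀ {Γ Δ} → Γ ↭ Δ → cedentSize Γ ≡ cedentSize Δ
cedentSize-↭ p = sum-↭ (↭.map⁺ fmSize p)

cedentSize-++ˡ : ∀ Γ Δ → cedentSize Γ ≤ cedentSize (Γ ++ Δ)
cedentSize-++ˡ Γ Δ = subst (cedentSize Γ ≤_) (sym (cedentSize-++ Γ Δ)) (m≤m+n _ _)

width : Seq → ℕ
width (Γ ⇒ Δ) = length Γ + length Δ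

≈S-refl : ∀ {s} → s ≈S s
≈S-refl = ↭-refl , ↭-refl

≈S-sym : ∀ {s t} → s ≈S t → t ≈S s
≈S-sym (p , q) = ↭-sym p , ↭-sym q

≈S-trans : ∀ {s t u} → s ≈S t → t ≈S u → s ≈S u
≈S-trans (p , q) (p' , q') = ↭-trans p p' , ↭-trans q q'

seqSize-≈S : ∀ {s t} → s ≈S t → seqSize s ≡ seqSize t
seqSize-≈S {_ ⇒ _} {_ ⇒ _} (p , q) = cong suc (cong₂ _+_ (cedentSize-↭ p) (cedentSize-↭ q))

fmSize-pos : ∀ A → 1 ≤ fmSize A
fmSize-pos (atom _) = s≤s z≤n
fmSize-pos (_ ∧ _)  = s≤s z≤n
fmSize-pos (_ ∨ _)  = s≤s z≤n

fmSize≤1⇒isAtom : ∀ A → fmSize A ≤ 1 → isAtom A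
fmSize≤1⇒isAtom (atom _) _ = tt
fmSize≤1⇒isAtom (B ∧ C) (s≤s h) = contradiction (≤-trans (fmSize-pos B) (≤-trans (m≤m+n _ _) h)) λ ()
fmSize≤1⇒isAtom (B ∨ C) (s≤s h) = contradiction (≤-trans (fmSize-pos B) (≤-trans (m≤m+n _ _) h)) λ ()

seqSize-cutFormula : ∀ Γ A Δ → seqSize (Γ ⇒ A ∷ Δ) ≡ fmSize A + seqSize (Γ ⇒ Δ)
seqSize-cutFormula Γ A Δ = shuffle (cedentSize Γ) (fmSize A) (cedentSize Δ)
  where
  shuffle : ∀ g a d → suc (g + (a + d)) ≡ a + suc (g + d)
  shuffle = solve-∀

antecedent-head-mono : ∀ A B Γ Δ → fmSize A ≤ fmSize B → seqSize (A ∷ Γ ⇒ Δ) ≤ seqSize (B ∷ Γ ⇒ Δ)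
antecedent-head-mono _ _ Γ Δ A≤B = s≤s (+-monoˡ-≤ (cedentSize Δ) (+-monoˡ-≤ (cedentSize Γ) A≤B))

succedent-head-mono : ∀ A B Γ Δ → fmSize A ≤ fmSize B → seqSize (Γ ⇒ A ∷ Δ) ≤ seqSize (Γ ⇒ B ∷ Δ)
succedent-head-mono _ _ Γ Δ A≤B = s≤s (+-monoʳ-≤ (cedentSize Γ) (+-monoˡ-≤ (cedentSize Δ) A≤B))

left-operand≤ : ∀ A B → fmSize A ≤ suc (fmSize A + fmSize B)
left-operand≤ A B = m≤n⇒m≤1+n (m≤m+n _ _)

right-operand≤ : ∀ A B → fmSize B ≤ suc (fmSize A + fmSize B)
right-operand≤ A B = m≤n⇒m≤1+n (m≤n+m _ _)

seqSize-++ : ∀ Γ Γ' Δ Δ' → seqSize (Γ ⇒ Δ) ≤ seqSize (Γ ++ Γ' ⇒ Δ ++ Δ')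
seqSize-++ Γ Γ' Δ Δ' = s≤s (+-mono-≤ (cedentSize-++ˡ Γ Γ') (cedentSize-++ˡ Δ Δ'))

-- Inference systems with bounded growth of sequents

infix 4 _⊆ₛ_
_⊆ₛ_ : System → System → Set
ok ⊆ₛ ok' = ∀ {ps s} (r : Inf ps s) → ok r → ok' r

Growth : ℕ → System
Growth k {ps} {s} _ = All (λ q → seqSize q ≤ k + seqSize s) ps

cutFormula-growth : ∀ k Γ A Δ → seqSize (Γ ⇒ A ∷ Δ) ≤ k + seqSize (Γ ⇒ Δ) → fmSize A ≤ k
cutFormula-growth k Γ A Δ h =
  +-cancelʳ-≤ (seqSize (Γ ⇒ Δ)) (fmSize A) k
    (subst (_≤ k + seqSize (Γ ⇒ Δ)) (seqSize-cutFormula Γ A Δ) h)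

data CutView : ∀ {ps s} → Inf ps s → Set where
  cut   : ∀ {Γ Δ} A → CutView (cut {Γ} {Δ} A)
  other : ∀ {ps s} {r : Inf ps s} → CutFree r → AtomicCut r → CutView r

cutView : ∀ {ps s} (r : Inf ps s) → CutView r
cutView (cut A)     = cut A
cutView (ax _)      = other tt tt
cutView (axL _)     = other tt tt
cutView (axR _)     = other tt tt
cutView (contrL _)  = other tt tt
cutView (contrR _)  = other tt tt
cutView (weakL _)   = other tt tt
cutView (weakR _)   = other tt tt
cutView (∧L₁ _ _)   = other tt tt
cutView (∧L₂ _ _)   = other tt tt
cutView (∧R _ _)    = other tt tt
cutView (∨L _ _)    = other tt tt
cutView (∨R₁ _ _)   = other tt tt
cutView (∨R₂ _ _)   = other tt tt

Growth0⊆CutFree : Growth 0 ⊆ₛ CutFree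
Growth0⊆CutFree r g with cutView r
... | cut {Γ} {Δ} A = contradiction (≤-trans (fmSize-pos A) (cutFormula-growth 0 Γ A Δ (All.head g))) λ ()
... | other cf _    = cf

Growth1⊆AtomicCut : Growth 1 ⊆ₛ AtomicCut
Growth1⊆AtomicCut r g with cutView r
... | cut {Γ} {Δ} A = fmSize≤1⇒isAtom A (cutFormula-growth 1 Γ A Δ (All.head g))
... | other _ ac    = ac

Growth0⊆Growth1 : Growth 0 ⊆ₛ Growth 1
Growth0⊆Growth1 _ = All.map m≤n⇒m≤1+n

weakL-shrinks : ∀ {Γ Δ} A → Growth 0 (weakL {Γ} {Δ} A)
weakL-shrinks {Γ} {Δ} A = s≤s (+-monoˡ-≤ (cedentSize Δ) (m≤n+m (cedentSize Γ) (fmSize A))) ∷ []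

weakR-shrinks : ∀ {Γ Δ} A → Growth 0 (weakR {Γ} {Δ} A)
weakR-shrinks {Γ} {Δ} A = s≤s (+-monoʳ-≤ (cedentSize Γ) (m≤n+m (cedentSize Δ) (fmSize A))) ∷ []

∨L-shrinks : ∀ {Γ Δ} A B → Growth 0 (∨L {Γ} {Δ} A B)
∨L-shrinks {Γ} {Δ} A B =
  antecedent-head-mono A (A ∨ B) Γ Δ (left-operand≤ A B) ∷
  antecedent-head-mono B (A ∨ B) Γ Δ (right-operand≤ A B) ∷ []

∧R-shrinks : ∀ {Γ Δ} A B → Growth 0 (∧R {Γ} {Δ} A B)
∧R-shrinks {Γ} {Δ} A B =
  succedent-head-mono A (A ∧ B) Γ Δ (left-operand≤ A B) ∷
  succedent-head-mono B (A ∧ B) Γ Δ (right-operand≤ A B) ∷ []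

atomicCut-growth : ∀ Γ Δ p → Growth 1 (cut {Γ} {Δ} (atom p))
atomicCut-growth Γ Δ p = ≤-reflexive (seqSize-cutFormula Γ (atom p) Δ) ∷ ≤-refl ∷ []

private variable
  ok ok' : System
  k : ℕ
  G H : List Seq
  a b s t : Seq
  ps qs : List Seq

Step-map : ok ⊆ₛ ok' → Step ok ps s → Step ok' ps s
Step-map ok⊆ok' (ps' , s' , ps≈ , s≈ , r , o) = ps' , s' , ps≈ , s≈ , r , ok⊆ok' r o

Step-premises-resp : Pointwise _≈S_ qs ps → Step ok ps s → Step ok qs s
Step-premises-resp qs≈ps (ps' , s' , ps≈ , s≈ , r , o) =
  ps' , s' , Pointwise.transitive ≈S-trans qs≈ps ps≈ , s≈ , r , o

Step-conclusion-resp : s ≈S t → Step ok ps s → Step ok ps t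
Step-conclusion-resp s≈t (ps' , s' , ps≈ , s≈ , r , o) =
  ps' , s' , ps≈ , ≈S-trans (≈S-sym s≈t) s≈ , r , o

Step-growth : Step (Growth k) ps s → All (λ q → seqSize q ≤ k + seqSize s) ps
Step-growth {k} {s = s} (ps' , s' , ps≈ , s≈ , r , g) = go ps≈ g
  where
  s'≡s : seqSize s' ≡ seqSize s
  s'≡s = sym (seqSize-≈S s≈)
  go : ∀ {qs rs} → Pointwise _≈S_ qs rs → All (λ q → seqSize q ≤ k + seqSize s') rs →
       All (λ q → seqSize q ≤ k + seqSize s) qs
  go [] [] = []
  go (q≈ ∷ qs≈) (h ∷ hs) =
    subst₂ _≤_ (sym (seqSize-≈S q≈)) (cong (k +_) s'≡s) h ∷ go qs≈ hs

-- Derivation trees and their linearisation into proof lines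

conclusions : List Line → List Seq
conclusions = map proj₁

references : List Line → List ℕ
references = concatMap proj₂

record Holds (G : List Seq) (i : ℕ) (s : Seq) : Set where
  constructor holds
  field
    {actual} : Seq
    lookup   : nth G i ≡ just actual
    ≈target  : actual ≈S s

infix 4 _⊑_
_⊑_ : List Seq → List Seq → Set
H ⊑ G = ∀ {i s} → nth H i ≡ just s → nth G i ≡ just s

data Der (ok : System) (H : List Seq) : Seq → Set where
  hyp : ∀ i → Holds H i s → Der ok H s
  by₀ : Step ok [] s → Der ok H s
  by₁ : Step ok [ a ] s → Der ok H a → Der ok H s
  by₂ : Step ok (a ∷ b ∷ []) s → Der ok H a → Der ok H b → Der ok H s

count : Der ok H s → ℕ
count (hyp _ _)    = 0
count (by₀ _)      = 1
count (by₁ _ d)    = suc (count d)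
count (by₂ _ d e)  = suc (count d + count e)

IsRule : Der ok H s → Set
IsRule (hyp _ _) = ⊥
IsRule _         = ⊤

reorder : s ≈S t → Der ok H s → Der ok H t
reorder s≈t (hyp i (holds e u≈s))  = hyp i (holds e (≈S-trans u≈s s≈t))
reorder s≈t (by₀ st)               = by₀ (Step-conclusion-resp s≈t st)
reorder s≈t (by₁ st d)             = by₁ (Step-conclusion-resp s≈t st) d
reorder s≈t (by₂ st d e)           = by₂ (Step-conclusion-resp s≈t st) d e

count-reorder : (s≈t : s ≈S t) (d : Der ok H s) → count (reorder s≈t d) ≡ count d
count-reorder _ (hyp _ _)    = refl
count-reorder _ (by₀ _)      = refl
count-reorder _ (by₁ _ _)    = refl
count-reorder _ (by₂ _ _ _)  = refl

root : Der ok H s → ℕ → ℕ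
root (hyp i _)    n = i
root (by₀ _)      n = n
root (by₁ _ d)    n = n + count d
root (by₂ _ d e)  n = n + count d + count e

-- The lines of d when its first line gets index n.
compile : Der ok H s → ℕ → List Line
compile (hyp _ _)             n = []
compile {s = s} (by₀ _)       n = [ s , [] ]
compile {s = s} (by₁ _ d)     n = compile d n ++ [ s , [ root d n ] ]
compile {s = s} (by₂ _ d e)   n =
  (compile d n ++ compile e (n + count d)) ++ [ s , root d n ∷ root e (n + count d) ∷ [] ]

length-∷ʳ : ∀ {A : Set} (xs : List A) x → length (xs ++ [ x ]) ≡ suc (length xs)
length-∷ʳ xs x = trans (length-++ xs) (+-comm (length xs) 1)

last-++ : ∀ {A : Set} (xs ys : List A) {y} → last ys ≡ just y → last (xs ++ ys) ≡ just y
last-++ []           ys          e = e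
last-++ (_ ∷ [])     (_ ∷ _)     e = e
last-++ (_ ∷ x ∷ xs) ys          e = last-++ (x ∷ xs) ys e

compile-length : ∀ {n} (d : Der ok H s) → length (compile d n) ≡ count d
compile-length (hyp _ _) = refl
compile-length (by₀ _) = refl
compile-length {n = n} (by₁ _ d) = trans (length-∷ʳ (compile d n) _) (cong suc (compile-length d))
compile-length {n = n} (by₂ _ d e) =
  trans (length-∷ʳ (compile d n ++ compile e (n + count d)) _)
        (cong suc (trans (length-++ (compile d n)) (cong₂ _+_ (compile-length d) (compile-length e))))

context-++ : ∀ G L₁ L₂ → G ++ conclusions (L₁ ++ L₂) ≡ (G ++ conclusions L₁) ++ conclusions L₂
context-++ G L₁ L₂ =
  trans (cong (G ++_) (map-++ proj₁ L₁ L₂)) (sym (++-assoc G (conclusions L₁) (conclusions L₂)))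

context-length : ∀ G L → length (G ++ conclusions L) ≡ length G + length L
context-length G L = trans (length-++ G) (cong (length G +_) (length-map proj₁ L))

nth-++ˡ : ∀ {i} G X → nth G i ≡ just s → nth (G ++ X) i ≡ just s
nth-++ˡ {i = zero}  (_ ∷ _) X e = e
nth-++ˡ {i = suc i} (_ ∷ G) X e = nth-++ˡ G X e

nth-length : ∀ G X → nth (G ++ s ∷ X) (length G) ≡ just s
nth-length []      X = refl
nth-length (_ ∷ G) X = nth-length G X

Holds-++ : ∀ {i} X → Holds G i s → Holds (G ++ X) i s
Holds-++ {G = G} X (holds e t≈s) = holds (nth-++ˡ G X e) t≈s

ValidFrom-++ : ∀ L₁ L₂ → ValidFrom ok G L₁ → ValidFrom ok (G ++ conclusions L₁) L₂ →
  ValidFrom ok G (L₁ ++ L₂)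
ValidFrom-++ {ok = ok} {G = G} [] L₂ _ v₂ = subst (λ C → ValidFrom ok C L₂) (++-identityʳ G) v₂
ValidFrom-++ {ok = ok} {G = G} ((s , is) ∷ L₁) L₂ (line , v₁) v₂ =
  line , ValidFrom-++ L₁ L₂ v₁
           (subst (λ C → ValidFrom ok C L₂) (sym (++-assoc G [ s ] (conclusions L₁))) v₂)

ValidFrom-map : ok ⊆ₛ ok' → ∀ L → ValidFrom ok G L → ValidFrom ok' G L
ValidFrom-map ok⊆ok' [] _ = tt
ValidFrom-map ok⊆ok' (_ ∷ L) ((ps , refs , st) , v) =
  (ps , refs , Step-map ok⊆ok' st) , ValidFrom-map ok⊆ok' L v

exact-premises : ∀ C {is} → Pointwise (Holds C) is ps →
  Σ (List Seq) λ ps' → Pointwise (λ i p → nth C i ≡ just p) is ps' × Pointwise _≈S_ ps' ps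
exact-premises C [] = [] , [] , []
exact-premises C (holds {t} e t≈ ∷ hs) =
  let ps' , es , ps'≈ = exact-premises C hs in t ∷ ps' , e ∷ es , t≈ ∷ ps'≈

append-line : ∀ G L is → ValidFrom ok G L → Pointwise (Holds (G ++ conclusions L)) is ps → Step ok ps s →
  ∀ {m} → length G + length L ≡ m →
  ValidFrom ok G (L ++ [ s , is ]) × Holds (G ++ conclusions (L ++ [ s , is ])) m s
append-line {s = s} G L is v hs st refl =
  let ps' , es , ps'≈ = exact-premises (G ++ conclusions L) hs in
  ValidFrom-++ L _ v ((ps' , es , Step-premises-resp ps'≈ st) , tt) ,
  holds (subst (λ C → nth C (length G + length L) ≡ just s) (sym (context-++ G L _))
           (subst (λ i → nth ((G ++ conclusions L) ++ [ s ]) i ≡ just s) (context-length G L)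
                  (nth-length (G ++ conclusions L) [])))
        ≈S-refl

compile-valid : ∀ {n} (d : Der ok H s) → length G ≡ n → H ⊑ G →
  ValidFrom ok G (compile d n) × Holds (G ++ conclusions (compile d n)) (root d n) s
compile-valid {G = G} (hyp i (holds e t≈s)) _ H⊑G = tt , holds (nth-++ˡ G [] (H⊑G e)) t≈s
compile-valid {G = G} (by₀ st) G≡n _ = append-line G [] [] tt [] st (trans (+-identityʳ _) G≡n)
compile-valid {G = G} {n = n} (by₁ st d) G≡n H⊑G =
  let v , h = compile-valid d G≡n H⊑G in
  append-line G (compile d n) _ v (h ∷ []) st (cong₂ _+_ G≡n (compile-length d))
compile-valid {ok = ok} {G = G} {n = n} (by₂ st d e) G≡n H⊑G =
  let v₁ , h₁ = compile-valid d G≡n H⊑G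
      v₂ , h₂ = compile-valid e G₁≡n' (λ x → nth-++ˡ G _ (H⊑G x))
  in append-line G L₁₂ _ (ValidFrom-++ L₁ L₂ v₁ v₂)
       (subst (λ C → Holds C (root d n) _) (sym (context-++ G L₁ L₂))
              (Holds-++ {G = G ++ conclusions L₁} (conclusions L₂) h₁)
        ∷ subst (λ C → Holds C _ _) (sym (context-++ G L₁ L₂)) h₂ ∷ [])
       st L₁₂-length
  where
  L₁ = compile d n
  L₂ = compile e (n + count d)
  L₁₂ = L₁ ++ L₂
  G₁≡n' : length (G ++ conclusions L₁) ≡ n + count d
  G₁≡n' = trans (context-length G L₁) (cong₂ _+_ G≡n (compile-length d))
  L₁₂-length : length G + length L₁₂ ≡ n + count d + count e
  L₁₂-length =
    trans (cong₂ _+_ G≡n (trans (length-++ L₁) (cong₂ _+_ (compile-length d) (compile-length e))))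
          (sym (+-assoc n (count d) (count e)))

compile-last : ∀ {n} (d : Der ok H s) → IsRule d → last (conclusions (compile d n)) ≡ just s
compile-last (by₀ _) _ = refl
compile-last {n = n} (by₁ _ d) _ =
  trans (cong last (map-++ proj₁ (compile d n) _)) (last-++ (conclusions (compile d n)) _ refl)
compile-last {n = n} (by₂ _ d e) _ =
  trans (cong last (map-++ proj₁ L _)) (last-++ (conclusions L) _ refl)
  where L = compile d n ++ compile e (n + count d)

InRange : ℕ → ℕ → ℕ → Set
InRange n m i = n ≤ i × i < m

InRange-widen : ∀ {n n' m m' i} → n' ≤ n → m ≤ m' → InRange n m i → InRange n' m' i
InRange-widen n'≤n m≤m' (n≤i , i<m) = ≤-trans n'≤n n≤i , <-≤-trans i<m m≤m'

Unique-separated : ∀ {xs ys : List ℕ} k → Unique xs → Unique ys → All (_< k) xs → All (k ≤_) ys →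
  Unique (xs ++ ys)
Unique-separated k uxs uys xs<k k≤ys =
  AllPairs.++⁺ uxs uys (All.map (λ x<k → All.map (λ k≤y → <⇒≢ (<-≤-trans x<k k≤y)) k≤ys) xs<k)

Unique-++⁻ˡ : ∀ {xs ys : List ℕ} → Unique (xs ++ ys) → Unique xs
Unique-++⁻ˡ {[]}     _          = []
Unique-++⁻ˡ {_ ∷ xs} (x∉ ∷ u)   = AllP.++⁻ˡ xs x∉ ∷ Unique-++⁻ˡ u

interleave-↭ : ∀ {A : Set} (xs ys : List A) x y z →
  ((xs ++ ys) ++ x ∷ y ∷ []) ++ [ z ] ↭ (xs ++ [ x ]) ++ ((ys ++ [ y ]) ++ [ z ])
interleave-↭ xs ys x y z = begin
  ((xs ++ ys) ++ x ∷ y ∷ []) ++ [ z ]          ≡⟨ ++-assoc (xs ++ ys) _ _ ⟩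
  (xs ++ ys) ++ x ∷ y ∷ z ∷ []                 ≡⟨ ++-assoc xs ys _ ⟩
  xs ++ (ys ++ x ∷ y ∷ z ∷ [])                 ↭⟨ ↭.++⁺ˡ xs (↭.shift x ys (y ∷ z ∷ [])) ⟩
  xs ++ x ∷ (ys ++ y ∷ z ∷ [])                 ≡⟨ cong (λ zs → xs ++ x ∷ zs) (sym (++-assoc ys [ y ] [ z ])) ⟩
  xs ++ x ∷ ((ys ++ [ y ]) ++ [ z ])           ≡⟨ sym (++-assoc xs [ x ] _) ⟩
  (xs ++ [ x ]) ++ ((ys ++ [ y ]) ++ [ z ])    ∎
  where open PermutationReasoning

-- Every index in the range of the lines of d occurs exactly once among their references and the root.
span : Der ok H s → ℕ → List ℕ
span d n = references (compile d n) ++ [ root d n ]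

span-unique : (d : Der ok [] s) → ∀ n → Unique (span d n) × All (InRange n (n + count d)) (span d n)
span-unique (hyp _ (holds () _))
span-unique (by₀ _) n = [] ∷ [] , (≤-refl , m<m+n n (s≤s z≤n)) ∷ []
span-unique (by₁ st d) n =
  subst (λ is → Unique is × All (InRange n (n + suc (count d))) is) (sym spanEq)
    ( Unique-separated (n + count d) u ([] ∷ []) (All.map proj₂ range) (≤-refl ∷ [])
    , AllP.++⁺ (All.map (InRange-widen ≤-refl (+-monoʳ-≤ n (n≤1+n _))) range)
               ((m≤m+n n _ , +-monoʳ-< n ≤-refl) ∷ []))
  where
  u = proj₁ (span-unique d n)
  range = proj₂ (span-unique d n)
  spanEq : span (by₁ st d) n ≡ span d n ++ [ n + count d ]
  spanEq = cong (_++ [ n + count d ]) (concatMap-++ proj₂ (compile d n) _)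
span-unique (by₂ st d e) n =
  subst (λ is → Unique is × All (InRange n r₊) is) (sym spanEq)
    ( Unique-resp-↭ (↭⇒↭ₛ (↭-sym reshuffle)) unique
    , ↭.All-resp-↭ (↭-sym reshuffle) range)
  where
  n' = n + count d
  r = n' + count e
  r₊ = n + suc (count d + count e)
  ud = proj₁ (span-unique d n)
  rd = proj₂ (span-unique d n)
  ue = proj₁ (span-unique e n')
  re = proj₂ (span-unique e n')
  r<r₊ : r < r₊
  r<r₊ = subst (r <_) (sym (+-suc n _)) (s≤s (≤-reflexive (+-assoc n (count d) (count e))))
  spanEq : span (by₂ st d e) n ≡
           ((references (compile d n) ++ references (compile e n')) ++ root d n ∷ root e n' ∷ []) ++ [ r ]
  spanEq = cong (_++ [ r ])
    (trans (concatMap-++ proj₂ (compile d n ++ compile e n') _)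
           (cong (_++ root d n ∷ root e n' ∷ []) (concatMap-++ proj₂ (compile d n) (compile e n'))))
  reshuffle = interleave-↭ (references (compile d n)) (references (compile e n')) (root d n) (root e n') r
  unique : Unique (span d n ++ (span e n' ++ [ r ]))
  unique = Unique-separated n' ud (Unique-separated r ue ([] ∷ []) (All.map proj₂ re) (≤-refl ∷ []))
             (All.map proj₂ rd) (AllP.++⁺ (All.map proj₁ re) (m≤m+n n' (count e) ∷ []))
  range : All (InRange n r₊) (span d n ++ (span e n' ++ [ r ]))
  range = AllP.++⁺ (All.map (InRange-widen ≤-refl (≤-trans (m≤m+n n' (count e)) (<⇒≤ r<r₊))) rd)
            (AllP.++⁺ (All.map (InRange-widen (m≤m+n n (count d)) (<⇒≤ r<r₊)) re)
                      ((≤-trans (m≤m+n n (count d)) (m≤m+n n' (count e)) , r<r₊) ∷ []))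

compile-treeLike : (d : Der ok [] s) → ∀ n → TreeLike (compile d n)
compile-treeLike d n = Unique-++⁻ˡ (proj₁ (span-unique d n))

proofSize-++ : ∀ L₁ L₂ → proofSize (L₁ ++ L₂) ≡ proofSize L₁ + proofSize L₂
proofSize-++ L₁ L₂ =
  trans (cong sum (map-++ (λ l → seqSize (proj₁ l)) L₁ L₂)) (sum-++ (map (λ l → seqSize (proj₁ l)) L₁) _)

premise-budget : ∀ a s {k c N} → seqSize a ≤ k + seqSize s → c ≤ N →
  seqSize a + k * c ≤ seqSize s + k * suc N
premise-budget a s {k} {c} {N} a≤ c≤N = begin
  seqSize a + k * c          ≤⟨ +-mono-≤ a≤ (*-monoʳ-≤ k c≤N) ⟩
  (k + seqSize s) + k * N    ≡⟨ regroup k (seqSize s) N ⟩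
  seqSize s + k * suc N      ∎
  where
  open ≤-Reasoning
  regroup : ∀ k x N → (k + x) + k * N ≡ x + k * suc N
  regroup = solve-∀

-- Along a branch sequents grow by at most k symbols per inference, so no line exceeds seqSize s + k · count d.
compile-size : ∀ {n} → ok ⊆ₛ Growth k → (d : Der ok H s) →
  proofSize (compile d n) ≤ count d * (seqSize s + k * count d)
compile-size _ (hyp _ _) = z≤n
compile-size {k = k} {s = s} _ (by₀ _) = +-monoˡ-≤ 0 (m≤m+n (seqSize s) (k * 1))
compile-size {k = k} {s = s} {n = n} ok⊆ (by₁ {a = a} st d) = begin
  proofSize (compile d n ++ [ s , _ ])       ≡⟨ proofSize-++ (compile d n) _ ⟩
  proofSize (compile d n) + (seqSize s + 0)
      ≤⟨ +-mono-≤ (compile-size ok⊆ d) (≤-reflexive (+-identityʳ _)) ⟩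
  count d * (seqSize a + k * count d) + seqSize s
      ≤⟨ +-mono-≤ (*-monoʳ-≤ (count d) (premise-budget a s a≤ ≤-refl)) (m≤m+n (seqSize s) _) ⟩
  count d * X + X                            ≡⟨ +-comm (count d * X) X ⟩
  suc (count d) * X                          ∎
  where
  open ≤-Reasoning
  X = seqSize s + k * suc (count d)
  a≤ = All.head (Step-growth (Step-map ok⊆ st))
compile-size {k = k} {s = s} {n = n} ok⊆ (by₂ {a = a} {b = b} st d e) = begin
  proofSize ((L₁ ++ L₂) ++ [ s , _ ])
      ≡⟨ trans (proofSize-++ (L₁ ++ L₂) _) (cong (_+ (seqSize s + 0)) (proofSize-++ L₁ L₂)) ⟩
  (proofSize L₁ + proofSize L₂) + (seqSize s + 0)
      ≤⟨ +-mono-≤ (+-mono-≤ (compile-size ok⊆ d) (compile-size ok⊆ e)) (≤-reflexive (+-identityʳ _)) ⟩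
  (count d * (seqSize a + k * count d) + count e * (seqSize b + k * count e)) + seqSize s
      ≤⟨ +-mono-≤ (+-mono-≤ (*-monoʳ-≤ (count d) (premise-budget a s a≤ (m≤m+n _ _)))
                            (*-monoʳ-≤ (count e) (premise-budget b s b≤ (m≤n+m _ _))))
                  (m≤m+n (seqSize s) _) ⟩
  (count d * X + count e * X) + X            ≡⟨ blocks (count d) (count e) X ⟩
  suc (count d + count e) * X                ∎
  where
  open ≤-Reasoning
  L₁ = compile d n
  L₂ = compile e (n + count d)
  X = seqSize s + k * suc (count d + count e)
  growth = Step-growth (Step-map ok⊆ st)
  a≤ = All.head growth
  b≤ = All.head (All.tail growth)
  blocks : ∀ c₁ c₂ X → (c₁ * X + c₂ * X) + X ≡ suc (c₁ + c₂) * X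
  blocks = solve-∀

-- Derived rules with inference counts

infixr 6 _∨*_ _∧*_

_∨*_ : Lit → List Fm → List Fm
p ∨* Γ = map (atom p ∨_) Γ

_∧*_ : Lit → List Fm → List Fm
p ∧* Δ = map (atom p ∧_) Δ

module Derivable {ok : System} (shrinking⊆ok : Growth 0 ⊆ₛ ok) where

  infix 2 _⊢⟨_⟩_
  record _⊢⟨_⟩_ (H : List Seq) (c : ℕ) (s : Seq) : Set where
    constructor derive
    field
      derivation : Der ok H s
      count≤     : count derivation ≤ c

  open _⊢⟨_⟩_ public

  private variable
    c c' K : ℕ
    Γ Δ : List Fm

  relax : c ≤ c' → H ⊢⟨ c ⟩ s → H ⊢⟨ c' ⟩ s
  relax c≤c' (derive d k) = derive d (≤-trans k c≤c')

  rearrange : s ≈S t → H ⊢⟨ c ⟩ s → H ⊢⟨ c ⟩ t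
  rearrange s≈t (derive d k) = derive (reorder s≈t d) (subst (_≤ _) (sym (count-reorder s≈t d)) k)

  assume : ∀ i → Holds H i s → H ⊢⟨ 0 ⟩ s
  assume i h = derive (hyp i h) z≤n

  axiom : Inf [] s → H ⊢⟨ 1 ⟩ s
  axiom r = derive (by₀ ([] , _ , [] , ≈S-refl , r , shrinking⊆ok r [])) ≤-refl

  infer₁ : (r : Inf [ a ] s) → Growth 0 r → H ⊢⟨ c ⟩ a → H ⊢⟨ suc c ⟩ s
  infer₁ r g (derive d k) =
    derive (by₁ (_ , _ , ≈S-refl ∷ [] , ≈S-refl , r , shrinking⊆ok r g) d) (s≤s k)

  rule₂ : (r : Inf (a ∷ b ∷ []) s) → ok r → H ⊢⟨ c ⟩ a → H ⊢⟨ c' ⟩ b → H ⊢⟨ suc (c + c') ⟩ s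
  rule₂ r o (derive d k) (derive e k') =
    derive (by₂ (_ , _ , ≈S-refl ∷ ≈S-refl ∷ [] , ≈S-refl , r , o) d e) (s≤s (+-mono-≤ k k'))

  infer₂ : (r : Inf (a ∷ b ∷ []) s) → Growth 0 r → H ⊢⟨ c ⟩ a → H ⊢⟨ c' ⟩ b → H ⊢⟨ suc (c + c') ⟩ s
  infer₂ r g = rule₂ r (shrinking⊆ok r g)

  weakenˡ : ∀ Xs → H ⊢⟨ c ⟩ (Γ ⇒ Δ) → H ⊢⟨ c + length Xs ⟩ (Xs ++ Γ ⇒ Δ)
  weakenˡ {c = c} [] d = relax (m≤m+n c 0) d
  weakenˡ {c = c} (X ∷ Xs) d =
    relax (≤-reflexive (sym (+-suc c (length Xs)))) (infer₁ (weakL X) (weakL-shrinks X) (weakenˡ Xs d))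

  weakenʳ : ∀ Ys → H ⊢⟨ c ⟩ (Γ ⇒ Δ) → H ⊢⟨ c + length Ys ⟩ (Γ ⇒ Ys ++ Δ)
  weakenʳ {c = c} [] d = relax (m≤m+n c 0) d
  weakenʳ {c = c} (Y ∷ Ys) d =
    relax (≤-reflexive (sym (+-suc c (length Ys)))) (infer₁ (weakR Y) (weakR-shrinks Y) (weakenʳ Ys d))

  weaken : ∀ Xs Ys → H ⊢⟨ c ⟩ (Γ ⇒ Δ) → H ⊢⟨ c + (length Xs + length Ys) ⟩ (Γ ++ Xs ⇒ Δ ++ Ys)
  weaken {c = c} {Γ = Γ} {Δ = Δ} Xs Ys d =
    relax (≤-reflexive (trans (+-assoc c _ _) (cong (c +_) (+-comm (length Ys) (length Xs)))))
      (rearrange (↭.++-comm Xs Γ , ↭.++-comm Ys Δ) (weakenˡ Xs (weakenʳ Ys d)))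

  private
    chain-count : ∀ c K l → suc ((K + l) + (c + l * (suc K + l))) ≡ c + suc l * (K + suc l)
    chain-count = solve-∀

  -- A side premise still contains the Γ' disjunctions not yet split, so its cost may grow with Γ'.
  ∨L-chain : ∀ X L Γ Δ →
    (∀ Γ' → H ⊢⟨ K + length Γ' ⟩ (X ∷ Γ' ++ Γ ⇒ Δ)) →
    H ⊢⟨ c ⟩ (L ++ Γ ⇒ Δ) →
    H ⊢⟨ c + length L * (K + length L) ⟩ (map (X ∨_) L ++ Γ ⇒ Δ)
  ∨L-chain {c = c} X [] Γ Δ _ main = relax (m≤m+n c 0) main
  ∨L-chain {H = H} {K = K} {c = c} X (D ∷ L) Γ Δ side main =
    relax (≤-reflexive (chain-count c K (length L)))
      (infer₂ (∨L X D) (∨L-shrinks X D)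
         (relax (≤-reflexive (cong (K +_) (length-map (X ∨_) L))) (side (map (X ∨_) L)))
         (rearrange (↭.shift D (map (X ∨_) L) Γ , ↭-refl) (∨L-chain X L (D ∷ Γ) Δ side′ main′)))
    where
    side′ : ∀ Γ' → H ⊢⟨ suc K + length Γ' ⟩ (X ∷ Γ' ++ D ∷ Γ ⇒ Δ)
    side′ Γ' = subst (λ Θ → H ⊢⟨ suc K + length Γ' ⟩ (X ∷ Θ ⇒ Δ)) (++-assoc Γ' [ D ] Γ)
                 (relax (≤-reflexive (trans (cong (K +_) (length-∷ʳ Γ' D)) (+-suc K _))) (side (Γ' ++ [ D ])))
    main′ : H ⊢⟨ c ⟩ (L ++ D ∷ Γ ⇒ Δ)
    main′ = rearrange (↭-sym (↭.shift D L Γ) , ↭-refl) main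

  ∧R-chain : ∀ X L Γ Δ →
    (∀ Δ' → H ⊢⟨ K + length Δ' ⟩ (Γ ⇒ X ∷ Δ' ++ Δ)) →
    H ⊢⟨ c ⟩ (Γ ⇒ L ++ Δ) →
    H ⊢⟨ c + length L * (K + length L) ⟩ (Γ ⇒ map (X ∧_) L ++ Δ)
  ∧R-chain {c = c} X [] Γ Δ _ main = relax (m≤m+n c 0) main
  ∧R-chain {H = H} {K = K} {c = c} X (D ∷ L) Γ Δ side main =
    relax (≤-reflexive (chain-count c K (length L)))
      (infer₂ (∧R X D) (∧R-shrinks X D)
         (relax (≤-reflexive (cong (K +_) (length-map (X ∧_) L))) (side (map (X ∧_) L)))
         (rearrange (↭-refl , ↭.shift D (map (X ∧_) L) Δ) (∧R-chain X L Γ (D ∷ Δ) side′ main′)))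
    where
    side′ : ∀ Δ' → H ⊢⟨ suc K + length Δ' ⟩ (Γ ⇒ X ∷ Δ' ++ D ∷ Δ)
    side′ Δ' = subst (λ Θ → H ⊢⟨ suc K + length Δ' ⟩ (Γ ⇒ X ∷ Θ)) (++-assoc Δ' [ D ] Δ)
                 (relax (≤-reflexive (trans (cong (K +_) (length-∷ʳ Δ' D)) (+-suc K _))) (side (Δ' ++ [ D ])))
    main′ : H ⊢⟨ c ⟩ (Γ ⇒ L ++ D ∷ Δ)
    main′ = rearrange (↭-refl , ↭-sym (↭.shift D L Δ)) main

  private
    weakening-count : ∀ (f : Fm → Fm) Ts n → n + length (map f Ts) ≡ length Ts + n
    weakening-count f Ts n = trans (cong (n +_) (length-map f Ts)) (+-comm n (length Ts))

    guard-count : ∀ c a t → ((c + 1) + t * (suc a + t)) + a * (suc t + a) ≤ c + suc (a + t) ^ 2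
    guard-count c a t =
      subst (((c + 1) + t * (suc a + t)) + a * (suc t + a) ≤_) (identity c a t) (m≤m+n _ (a + t))
      where
      identity : ∀ c a t → ((c + 1) + t * (suc a + t)) + a * (suc t + a) + (a + t)
                           ≡ c + suc (a + t) * (suc (a + t) * 1)
      identity = solve-∀

  guard-succedent : ∀ p Cs Ts → H ⊢⟨ c ⟩ (Cs ⇒ Ts) →
    H ⊢⟨ c + suc (width (Cs ⇒ Ts)) ^ 2 ⟩ (p ∨* Cs ⇒ atom p ∷ neg p ∧* Ts)
  guard-succedent {H = H} {c = c} p Cs Ts core =
    relax (guard-count c (length Cs) (length Ts))
      (rearrange (↭.++-identityʳ (p ∨* Cs) , ↭-refl) (∨L-chain P Cs [] (P ∷ NT) sideᵖ mainᵖ))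
    where
    P = atom p
    N = atom (neg p)
    NT = neg p ∧* Ts
    sideᴺ : ∀ Δ' → H ⊢⟨ suc (length Cs) + length Δ' ⟩ (Cs ⇒ N ∷ Δ' ++ [ P ])
    sideᴺ Δ' = rearrange (↭-refl , ↭.∷↭∷ʳ P (N ∷ Δ')) (weaken Cs Δ' (axiom (axR p)))
    mainᴺ : H ⊢⟨ c + 1 ⟩ (Cs ⇒ Ts ++ [ P ])
    mainᴺ = rearrange (↭.++-identityʳ Cs , ↭-refl) (weaken [] [ P ] core)
    sideᵖ : ∀ Γ' → H ⊢⟨ suc (length Ts) + length Γ' ⟩ (P ∷ Γ' ++ [] ⇒ P ∷ NT)
    sideᵖ Γ' = relax (≤-reflexive (cong suc (weakening-count (N ∧_) Ts (length Γ'))))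
                 (rearrange (↭.++⁺ˡ [ P ] (↭-sym (↭.++-identityʳ Γ')) , ↭-refl)
                            (weaken Γ' NT (axiom (ax p))))
    mainᵖ : H ⊢⟨ (c + 1) + length Ts * (suc (length Cs) + length Ts) ⟩ (Cs ++ [] ⇒ P ∷ NT)
    mainᵖ = rearrange (↭-sym (↭.++-identityʳ Cs) , ↭-sym (↭.∷↭∷ʳ P NT))
                      (∧R-chain N Ts Cs [ P ] sideᴺ mainᴺ)

  guard-antecedent : ∀ p Cs Ts → H ⊢⟨ c ⟩ (Cs ⇒ Ts) →
    H ⊢⟨ c + suc (width (Cs ⇒ Ts)) ^ 2 ⟩ (atom (neg p) ∷ p ∨* Cs ⇒ neg p ∧* Ts)
  guard-antecedent {H = H} {c = c} p Cs Ts core =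
    relax (guard-count c (length Cs) (length Ts))
      (rearrange (↭-sym (↭.∷↭∷ʳ N (p ∨* Cs)) , ↭-refl) (∨L-chain P Cs [ N ] NT sideᵖ mainᵖ))
    where
    P = atom p
    N = atom (neg p)
    NT = neg p ∧* Ts
    sideᴺ : ∀ Δ' → H ⊢⟨ suc (length Cs) + length Δ' ⟩ (Cs ++ [ N ] ⇒ N ∷ Δ' ++ [])
    sideᴺ Δ' = rearrange (↭.∷↭∷ʳ N Cs , ↭.++⁺ˡ [ N ] (↭-sym (↭.++-identityʳ Δ')))
                         (weaken Cs Δ' (axiom (ax (neg p))))
    mainᴺ : H ⊢⟨ c + 1 ⟩ (Cs ++ [ N ] ⇒ Ts ++ [])
    mainᴺ = weaken [ N ] [] core
    sideᵖ : ∀ Γ' → H ⊢⟨ suc (length Ts) + length Γ' ⟩ (P ∷ Γ' ++ [ N ] ⇒ NT)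
    sideᵖ Γ' = relax (≤-reflexive (cong suc (weakening-count (N ∧_) Ts (length Γ'))))
                 (rearrange (↭.++⁺ˡ [ P ] (↭.∷↭∷ʳ N Γ') , ↭-refl) (weaken Γ' NT (axiom (axL p))))
    mainᵖ : H ⊢⟨ (c + 1) + length Ts * (suc (length Cs) + length Ts) ⟩ (Cs ++ [ N ] ⇒ NT)
    mainᵖ = rearrange (↭-refl , ↭.++-identityʳ NT) (∧R-chain N Ts (Cs ++ [ N ]) [] sideᴺ mainᴺ)

  private
    combine-count : ∀ b u a t → ((b + u) + t * (a + t)) + a * (t + a) ≤ suc ((b + u) + (a + t)) ^ 2
    combine-count b u a t =
      subst (((b + u) + t * (a + t)) + a * (t + a) ≤_) (identity b u a t) (m≤m+n _ _)
      where
      identity : ∀ b u a t → ((b + u) + t * (a + t)) + a * (t + a)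
                               + ((b + u) * (b + u) + 2 * (b + u) * (a + t) + (b + u) + 2 * (a + t) + 1)
                             ≡ suc ((b + u) + (a + t)) * (suc ((b + u) + (a + t)) * 1)
      identity = solve-∀

  combine : ∀ p Bs Us Cs Ts →
    H ⊢⟨ 0 ⟩ (atom (neg p) ∷ p ∨* Bs ⇒ neg p ∧* Us) →
    H ⊢⟨ 0 ⟩ (p ∨* Bs ⇒ atom p ∷ neg p ∧* Us) →
    H ⊢⟨ 0 ⟩ (Cs ⇒ Ts) →
    H ⊢⟨ suc (width (Bs ⇒ Us) + width (Cs ⇒ Ts)) ^ 2 ⟩ (p ∨* Bs ++ neg p ∨* Cs ⇒ neg p ∧* Us ++ p ∧* Ts)
  combine {H = H} p Bs Us Cs Ts guardᴺ guardᴾ core =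
    relax (combine-count (length Bs) (length Us) (length Cs) (length Ts))
      (rearrange (↭.++-comm (neg p ∨* Cs) PB , ↭-refl) (∨L-chain N Cs PB (NT ++ PT) sideᴺ mainᴺ))
    where
    P = atom p
    N = atom (neg p)
    PB = p ∨* Bs
    NT = neg p ∧* Us
    PT = p ∧* Ts
    sideᴾ : ∀ Δ' → H ⊢⟨ length Cs + length Δ' ⟩ (Cs ++ PB ⇒ P ∷ Δ' ++ NT)
    sideᴾ Δ' = rearrange (↭.++-comm PB Cs , ↭.++⁺ˡ [ P ] (↭.++-comm NT Δ')) (weaken Cs Δ' guardᴾ)
    mainᴾ : H ⊢⟨ length Bs + length Us ⟩ (Cs ++ PB ⇒ Ts ++ NT)
    mainᴾ = relax (≤-reflexive (cong₂ _+_ (length-map (P ∨_) Bs) (length-map (N ∧_) Us))) (weaken PB NT core)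
    sideᴺ : ∀ Γ' → H ⊢⟨ length Ts + length Γ' ⟩ (N ∷ Γ' ++ PB ⇒ NT ++ PT)
    sideᴺ Γ' = relax (≤-reflexive (weakening-count (P ∧_) Ts (length Γ')))
                 (rearrange (↭.++⁺ˡ [ N ] (↭.++-comm PB Γ') , ↭-refl) (weaken Γ' PT guardᴺ))
    mainᴺ : H ⊢⟨ (length Bs + length Us) + length Ts * (length Cs + length Ts) ⟩ (Cs ++ PB ⇒ NT ++ PT)
    mainᴺ = rearrange (↭-refl , ↭.++-comm PT NT) (∧R-chain P Ts (Cs ++ PB) NT sideᴾ mainᴾ)

  combine-isRule : ∀ p Bs Us Cs Ts guardᴺ guardᴾ core → Cs ≢ [] →
    IsRule (derivation (combine {H = H} p Bs Us Cs Ts guardᴺ guardᴾ core))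
  combine-isRule p Bs Us []      Ts _ _ _ Cs≢[] = contradiction refl Cs≢[]
  combine-isRule p Bs Us (_ ∷ _) Ts _ _ _ _     = tt

neg-involutive : ∀ p → neg (neg p) ≡ p
neg-involutive (lit x b) = cong (lit x) (not-involutive b)

dtSequent : DT → Seq
dtSequent A = Cls A ⇒ Tms A

length-guarded : ∀ (f g : Fm → Fm) Γ Δ → length (map f Γ ++ map g Δ) ≡ length Γ + length Δ
length-guarded f g Γ Δ = trans (length-++ (map f Γ)) (cong₂ _+_ (length-map f Γ) (length-map g Δ))

width-dtSequent : ∀ A → width (dtSequent A) ≡ suc (dtSize A)
width-dtSequent (leaf p) = refl
width-dtSequent (node B p C) = begin
  length (Cls (node B p C)) + length (Tms (node B p C))
    ≡⟨ cong₂ _+_ (length-guarded (atom p ∨_) (atom (neg p) ∨_) (Cls B) (Cls C))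
                 (length-guarded (atom (neg p) ∧_) (atom p ∧_) (Tms B) (Tms C)) ⟩
  (length (Cls B) + length (Cls C)) + (length (Tms B) + length (Tms C))
    ≡⟨ +-comm-middle (length (Cls B)) (length (Cls C)) (length (Tms B)) (length (Tms C)) ⟩
  width (dtSequent B) + width (dtSequent C)
    ≡⟨ cong₂ _+_ (width-dtSequent B) (width-dtSequent C) ⟩
  suc (dtSize B) + suc (dtSize C)
    ≡⟨ cong suc (+-suc (dtSize B) (dtSize C)) ⟩
  suc (dtSize (node B p C)) ∎
  where
  open ≡-Reasoning
  +-comm-middle : ∀ a b c d → (a + b) + (c + d) ≡ (a + c) + (b + d)
  +-comm-middle = solve-∀

length-guards : ∀ q r Γ Δ → length (q ∨* Γ) + length (r ∧* Δ) ≡ width (Γ ⇒ Δ)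
length-guards q r Γ Δ = cong₂ _+_ (length-map (atom q ∨_) Γ) (length-map (atom r ∧_) Δ)

SizeBound : ℕ → List Fm → Set
SizeBound n Γ = length Γ ≤ n × cedentSize Γ ≤ n * n

cedentSize-guarded : ∀ (f : Fm → Fm) → (∀ D → fmSize (f D) ≡ 2 + fmSize D) →
  ∀ Γ → cedentSize (map f Γ) ≡ 2 * length Γ + cedentSize Γ
cedentSize-guarded f guard [] = refl
cedentSize-guarded f guard (D ∷ Γ) =
  trans (cong₂ _+_ (guard D) (cedentSize-guarded f guard Γ))
        (regroup (fmSize D) (length Γ) (cedentSize Γ))
  where
  regroup : ∀ x l y → (2 + x) + (2 * l + y) ≡ 2 * suc l + (x + y)
  regroup = solve-∀

SizeBound-guarded : ∀ {b c Γ Δ} (f g : Fm → Fm) →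
  (∀ D → fmSize (f D) ≡ 2 + fmSize D) → (∀ D → fmSize (g D) ≡ 2 + fmSize D) →
  SizeBound b Γ → SizeBound c Δ → SizeBound (suc (b + c)) (map f Γ ++ map g Δ)
SizeBound-guarded {b} {c} {Γ} {Δ} f g guard-f guard-g (lΓ , sΓ) (lΔ , sΔ) =
  ≤-trans (≤-reflexive (length-guarded f g Γ Δ)) (m≤n⇒m≤1+n (+-mono-≤ lΓ lΔ)) ,
  (begin
    cedentSize (map f Γ ++ map g Δ)
      ≡⟨ trans (cedentSize-++ (map f Γ) (map g Δ))
               (cong₂ _+_ (cedentSize-guarded f guard-f Γ) (cedentSize-guarded g guard-g Δ)) ⟩
    (2 * length Γ + cedentSize Γ) + (2 * length Δ + cedentSize Δ)
      ≤⟨ +-mono-≤ (+-mono-≤ (*-monoʳ-≤ 2 lΓ) sΓ) (+-mono-≤ (*-monoʳ-≤ 2 lΔ) sΔ) ⟩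
    (2 * b + b * b) + (2 * c + c * c)
      ≤⟨ m≤m+n _ _ ⟩
    (2 * b + b * b) + (2 * c + c * c) + (2 * b * c + 1)
      ≡⟨ square b c ⟩
    suc (b + c) * suc (b + c) ∎)
  where
  open ≤-Reasoning
  square : ∀ b c → (2 * b + b * b) + (2 * c + c * c) + (2 * b * c + 1) ≡ suc (b + c) * suc (b + c)
  square = solve-∀

Cls-bound : ∀ A → SizeBound (dtSize A) (Cls A)
Cls-bound (leaf p) = ≤-refl , ≤-refl
Cls-bound (node B p C) =
  SizeBound-guarded {Γ = Cls B} {Δ = Cls C} (atom p ∨_) (atom (neg p) ∨_) (λ _ → refl) (λ _ → refl)
                    (Cls-bound B) (Cls-bound C)

Tms-bound : ∀ A → SizeBound (dtSize A) (Tms A)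
Tms-bound (leaf p) = ≤-refl , ≤-refl
Tms-bound (node B p C) =
  SizeBound-guarded {Γ = Tms B} {Δ = Tms C} (atom (neg p) ∧_) (atom p ∧_) (λ _ → refl) (λ _ → refl)
                    (Tms-bound B) (Tms-bound C)

Cls-nonempty : ∀ A → Cls A ≢ []
Cls-nonempty (leaf _) ()
Cls-nonempty (node B p C) = guarded-nonempty (Cls B) (Cls-nonempty B)
  where
  guarded-nonempty : ∀ Γ {Δ} → Γ ≢ [] → p ∨* Γ ++ Δ ≢ []
  guarded-nonempty []      Γ≢[] _  = Γ≢[] refl
  guarded-nonempty (_ ∷ _) _    ()

seqSize-dtSequent : ∀ A → seqSize (dtSequent A) ≤ suc (dtSize A * dtSize A + dtSize A * dtSize A)
seqSize-dtSequent A = s≤s (+-mono-≤ (proj₂ (Cls-bound A)) (proj₂ (Tms-bound A)))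

dtSize-pos : ∀ A → 1 ≤ dtSize A
dtSize-pos (leaf _)     = s≤s z≤n
dtSize-pos (node _ _ _) = s≤s z≤n

power-recurrence : ∀ K k b c →
  K * b ^ suc k + K * c ^ suc k + K * suc (b + c) ^ k ≤ K * suc (b + c) ^ suc k
power-recurrence K k b c = begin
  K * b ^ suc k + K * c ^ suc k + K * N ^ k
    ≡⟨ sym (trans (*-distribˡ-+ K (b ^ suc k + c ^ suc k) _)
                  (cong (_+ K * N ^ k) (*-distribˡ-+ K (b ^ suc k) _))) ⟩
  K * (b * b ^ k + c * c ^ k + N ^ k)
    ≤⟨ *-monoʳ-≤ K (+-monoˡ-≤ (N ^ k)
         (+-mono-≤ (*-monoʳ-≤ b (^-monoˡ-≤ k b≤N)) (*-monoʳ-≤ c (^-monoˡ-≤ k c≤N)))) ⟩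
  K * (b * N ^ k + c * N ^ k + N ^ k)
    ≡⟨ cong (K *_) (trans (+-comm _ (N ^ k)) (cong (N ^ k +_) (sym (*-distribʳ-+ (N ^ k) b c)))) ⟩
  K * N ^ suc k ∎
  where
  open ≤-Reasoning
  N = suc (b + c)
  b≤N : b ≤ N
  b≤N = m≤n⇒m≤1+n (m≤m+n b c)
  c≤N : c ≤ N
  c≤N = m≤n⇒m≤1+n (m≤n+m c b)

-- The tree-like proof with atomic cuts

tree-count : ∀ b c {wB wC lB lC} → wB ≡ suc b → wC ≡ suc c → lB ≡ wB → lC ≡ wC →
  suc ((27 * b ^ 3 + suc wB ^ 2) + lC + ((27 * c ^ 3 + suc wC ^ 2) + lB)) ≤ 27 * suc (b + c) ^ 3
tree-count b c refl refl refl refl = begin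
  suc ((27 * b ^ 3 + suc (suc b) ^ 2) + suc c + ((27 * c ^ 3 + suc (suc c) ^ 2) + suc b))
    ≤⟨ m≤m+n _ _ ⟩
  _ ≡⟨ overhead b c ⟩
  27 * b ^ 3 + 27 * c ^ 3 + 27 * suc (b + c) ^ 2
    ≤⟨ power-recurrence 27 2 b c ⟩
  27 * suc (b + c) ^ 3 ∎
  where
  open ≤-Reasoning
  overhead : ∀ b c →
    suc ((27 * (b * (b * (b * 1))) + suc (suc b) * (suc (suc b) * 1)) + suc c
         + ((27 * (c * (c * (c * 1))) + suc (suc c) * (suc (suc c) * 1)) + suc b))
    + (26 * b * b + 26 * c * c + 54 * b * c + 49 * b + 49 * c + 16)
    ≡ 27 * (b * (b * (b * 1))) + 27 * (c * (c * (c * 1))) + 27 * (suc (b + c) * (suc (b + c) * 1))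
  overhead = solve-∀

module AtomicCutTree where
  open Derivable {Growth 1} Growth0⊆Growth1

  tree : ∀ A → [] ⊢⟨ 27 * dtSize A ^ 3 ⟩ dtSequent A
  tree (leaf p) = relax (s≤s z≤n) (axiom (ax p))
  tree (node B p C) =
    relax (tree-count (dtSize B) (dtSize C) (width-dtSequent B) (width-dtSequent C)
                      (length-guards p (neg p) (Cls B) (Tms B)) (length-guards (neg p) p (Cls C) (Tms C)))
          (rule₂ (cut (atom p)) (atomicCut-growth (Cls A) (Tms A) p) left right)
    where
    A = node B p C
    PB = p ∨* Cls B
    NC = neg p ∨* Cls C
    NT = neg p ∧* Tms B
    PT = p ∧* Tms C
    left : [] ⊢⟨ (27 * dtSize B ^ 3 + suc (width (dtSequent B)) ^ 2) + (length NC + length PT) ⟩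
             (Cls A ⇒ atom p ∷ Tms A)
    left = weaken NC PT (guard-succedent p (Cls B) (Tms B) (tree B))
    guardedC : [] ⊢⟨ 27 * dtSize C ^ 3 + suc (width (dtSequent C)) ^ 2 ⟩ (atom p ∷ NC ⇒ PT)
    guardedC = subst (λ q → [] ⊢⟨ _ ⟩ (atom q ∷ NC ⇒ q ∧* Tms C)) (neg-involutive p)
                     (guard-antecedent (neg p) (Cls C) (Tms C) (tree C))
    right : [] ⊢⟨ (27 * dtSize C ^ 3 + suc (width (dtSequent C)) ^ 2) + (length PB + length NT) ⟩
              (atom p ∷ Cls A ⇒ Tms A)
    right = rearrange (↭.++⁺ˡ [ atom p ] (↭.++-comm NC PB) , ↭.++-comm PT NT) (weaken PB NT guardedC)

  tree-isRule : ∀ A → IsRule (derivation (tree A))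
  tree-isRule (leaf _)     = tt
  tree-isRule (node _ _ _) = tt

-- The dag-like cut-free proof

dag-overhead : ∀ b c {wB wC x₁ x₂ y} → wB ≡ suc b → wC ≡ suc c →
  let M = suc (suc (suc (b + c) * suc (b + c) + suc (b + c) * suc (b + c))) in
  x₁ ≤ M → x₂ ≤ M → y ≤ M →
  suc wB ^ 2 * x₁ + (suc wB ^ 2 * x₂ + suc (wB + wC) ^ 2 * y) ≤ 108 * suc (b + c) ^ 4
dag-overhead b c {x₁ = x₁} {x₂} {y} refl refl x₁≤ x₂≤ y≤ = begin
  B² * x₁ + (B² * x₂ + Q * y)
    ≤⟨ +-mono-≤ (*-mono-≤ B²≤Q x₁≤) (+-mono-≤ (*-mono-≤ B²≤Q x₂≤) (*-monoʳ-≤ Q y≤)) ⟩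
  Q * M + (Q * M + Q * M)
    ≡⟨ cong (λ q → q * M + (q * M + q * M)) (cong (λ x → suc (suc x) ^ 2) (+-suc b c)) ⟩
  _ ≤⟨ m≤m+n _ _ ⟩
  _ ≡⟨ identity (b + c) ⟩
  108 * suc (b + c) ^ 4 ∎
  where
  open ≤-Reasoning
  B² = suc (suc b) ^ 2
  Q = suc (suc b + suc c) ^ 2
  M = suc (suc (suc (b + c) * suc (b + c) + suc (b + c) * suc (b + c)))
  B²≤Q : B² ≤ Q
  B²≤Q = ^-monoˡ-≤ 2 (s≤s (m≤m+n (suc b) (suc c)))
  identity : ∀ m → let q = suc (suc (suc m)) * (suc (suc (suc m)) * 1)
                       M = suc (suc (suc m * suc m + suc m * suc m)) in
    q * M + (q * M + q * M) + (102 * (m * m * m * m) + 384 * (m * m * m) + 510 * (m * m) + 252 * m)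
    ≡ 108 * (suc m * (suc m * (suc m * (suc m * 1))))
  identity = solve-∀

record Extension (G : List Seq) (s : Seq) (N : ℕ) : Set where
  field
    lines  : List Line
    valid  : ValidFrom CutFree G lines
    index  : ℕ
    available : Holds (G ++ conclusions lines) index s
    size≤  : proofSize lines ≤ N

open Extension

Extension-relax : ∀ {N N'} → N ≤ N' → Extension G s N → Extension G s N'
Extension-relax N≤N' E = record
  { lines = lines E ; valid = valid E ; index = index E ; available = available E
  ; size≤ = ≤-trans (size≤ E) N≤N' }

infixr 4 _⨾_
_⨾_ : ∀ {N M} (E : Extension G s N) → Extension (G ++ conclusions (lines E)) t M → Extension G t (N + M)
_⨾_ {G = G} E F = record
  { lines = lines E ++ lines F
  ; valid = ValidFrom-++ (lines E) (lines F) (valid E) (valid F)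
  ; index = index F
  ; available = subst (λ C → Holds C (index F) _) (sym (context-++ G (lines E) (lines F))) (available F)
  ; size≤ = subst (_≤ _) (sym (proofSize-++ (lines E) (lines F))) (+-mono-≤ (size≤ E) (size≤ F))
  }

⨾-last : ∀ {N M} (E : Extension G s N) (F : Extension (G ++ conclusions (lines E)) t M) →
  last (conclusions (lines F)) ≡ just t → last (conclusions (lines (E ⨾ F))) ≡ just t
⨾-last E F e = trans (cong last (map-++ proj₁ (lines E) (lines F))) (last-++ (conclusions (lines E)) _ e)

module CutFreeDag where
  open Derivable {Growth 0} (λ _ g → g)

  extension : G ⊢⟨ k ⟩ s → Extension G s (k * seqSize s)
  extension {G = G} {k = k} {s = s} (derive d count≤k) = record
    { lines = compile d (length G)
    ; valid = ValidFrom-map Growth0⊆CutFree _ (proj₁ V)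
    ; index = root d (length G)
    ; available = proj₂ V
    ; size≤ = ≤-trans (compile-size {k = 0} {n = length G} (λ _ g → g) d)
                      (*-mono-≤ count≤k (≤-reflexive (+-identityʳ (seqSize s))))
    }
    where
    V = compile-valid d refl (λ e → e)

  extension-last : (D : G ⊢⟨ k ⟩ s) → IsRule (derivation D) →
    last (conclusions (lines (extension D))) ≡ just s
  extension-last {G = G} (derive d _) = compile-last {n = length G} d

  DagProof : List Seq → DT → Set
  DagProof G A = Σ (Extension G (dtSequent A) (108 * dtSize A ^ 5)) λ E →
                   last (conclusions (lines E)) ≡ just (dtSequent A)

  dag : ∀ A G → DagProof G A
  dag (leaf p) G = Extension-relax (s≤s (s≤s (s≤s z≤n))) (extension (axiom (ax p))) , refl
  dag (node B p C) G =
    Extension-relax size-bound (EB ⨾ EC ⨾ E₁ ⨾ E₂ ⨾ E₃) ,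
    ⨾-last EB (EC ⨾ E₁ ⨾ E₂ ⨾ E₃)
      (⨾-last EC (E₁ ⨾ E₂ ⨾ E₃) (⨾-last E₁ (E₂ ⨾ E₃) (⨾-last E₂ E₃ last₃)))
    where
    A = node B p C
    EB = proj₁ (dag B G)
    EC = proj₁ (dag C (G ++ conclusions (lines EB)))
    hB : Holds ((G ++ conclusions (lines EB)) ++ conclusions (lines EC)) (index EB) (dtSequent B)
    hB = Holds-++ (conclusions (lines EC)) (available EB)
    E₁ = extension (guard-antecedent p (Cls B) (Tms B) (assume _ hB))
    E₂ = extension (guard-succedent p (Cls B) (Tms B) (assume _ (Holds-++ (conclusions (lines E₁)) hB)))
    joined = combine p (Cls B) (Tms B) (Cls C) (Tms C)
          (assume _ (Holds-++ (conclusions (lines E₂)) (available E₁)))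
          (assume _ (available E₂))
          (assume _ (Holds-++ (conclusions (lines E₂)) (Holds-++ (conclusions (lines E₁)) (available EC))))
    E₃ = extension joined
    last₃ = extension-last joined (combine-isRule p (Cls B) (Tms B) (Cls C) (Tms C) _ _ _ (Cls-nonempty C))
    size = dtSize A
    M = suc (suc (size * size + size * size))
    PB = p ∨* Cls B
    NT = neg p ∧* Tms B
    A-size : seqSize (dtSequent A) ≤ M
    A-size = m≤n⇒m≤1+n (seqSize-dtSequent A)
    guardᴺ-size : seqSize (atom (neg p) ∷ PB ⇒ NT) ≤ M
    guardᴺ-size = s≤s (≤-trans (seqSize-++ PB (neg p ∨* Cls C) NT (p ∧* Tms C)) (seqSize-dtSequent A))
    guardᴾ-size : seqSize (PB ⇒ atom p ∷ NT) ≤ M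
    guardᴾ-size = subst (_≤ M) (sym (seqSize-cutFormula PB (atom p) NT)) guardᴺ-size
    size-bound : 108 * dtSize B ^ 5 + (108 * dtSize C ^ 5
                   + (suc (width (dtSequent B)) ^ 2 * seqSize (atom (neg p) ∷ PB ⇒ NT)
                   + (suc (width (dtSequent B)) ^ 2 * seqSize (PB ⇒ atom p ∷ NT)
                   + suc (width (dtSequent B) + width (dtSequent C)) ^ 2 * seqSize (dtSequent A))))
                 ≤ 108 * size ^ 5
    size-bound = begin
      108 * dtSize B ^ 5 + (108 * dtSize C ^ 5 + _) ≡⟨ sym (+-assoc (108 * dtSize B ^ 5) _ _) ⟩
      108 * dtSize B ^ 5 + 108 * dtSize C ^ 5 + _
        ≤⟨ +-monoʳ-≤ _ (dag-overhead (dtSize B) (dtSize C) (width-dtSequent B) (width-dtSequent C)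
                                     guardᴺ-size guardᴾ-size A-size) ⟩
      108 * dtSize B ^ 5 + 108 * dtSize C ^ 5 + 108 * size ^ 4 ≤⟨ power-recurrence 108 4 (dtSize B) (dtSize C) ⟩
      108 * size ^ 5 ∎
      where open ≤-Reasoning

tree-size-bound : ∀ n {c x} → 1 ≤ n → c ≤ 27 * n ^ 3 → x ≤ suc (n * n + n * n) →
  c * (x + 1 * c) ≤ 810 * n ^ 6 + 810
tree-size-bound (suc m) {c} {x} _ c≤ x≤ = begin
  c * (x + 1 * c)                              ≤⟨ *-mono-≤ c≤ (+-mono-≤ x≤ (*-monoʳ-≤ 1 c≤)) ⟩
  27 * n ^ 3 * (suc (n * n + n * n) + 1 * (27 * n ^ 3))
    ≤⟨ *-monoʳ-≤ (27 * n ^ 3) (+-monoˡ-≤ (1 * (27 * n ^ 3)) square≤cube) ⟩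
  27 * n ^ 3 * (3 * n ^ 3 + 1 * (27 * n ^ 3))  ≡⟨ product m ⟩
  810 * n ^ 6                                  ≤⟨ m≤m+n _ 810 ⟩
  810 * n ^ 6 + 810                            ∎
  where
  open ≤-Reasoning
  n = suc m
  square≤cube : suc (n * n + n * n) ≤ 3 * n ^ 3
  square≤cube = subst (suc (n * n + n * n) ≤_) (identity m) (m≤m+n _ _)
    where
    identity : ∀ m → suc (suc m * suc m + suc m * suc m) + (3 * (m * m * m) + 7 * (m * m) + 5 * m)
                     ≡ 3 * (suc m * (suc m * (suc m * 1)))
    identity = solve-∀
  product : ∀ m → let n³ = suc m * (suc m * (suc m * 1)) in
    27 * n³ * (3 * n³ + 1 * (27 * n³)) ≡ 810 * (suc m * (suc m * (suc m * (suc m * (suc m * (suc m * 1))))))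
  product = solve-∀

dag-size-bound : ∀ n {x} → 1 ≤ n → x ≤ 108 * n ^ 5 → x ≤ 810 * n ^ 6 + 810
dag-size-bound (suc m) _ x≤ =
  ≤-trans x≤ (≤-trans (*-mono-≤ (m≤m+n 108 702) (m≤n*m (suc m ^ 5) (suc m))) (m≤m+n _ 810))

atomic-cut-proof : ∀ A → Σ (List Line) λ P →
  IsProof AtomicCut P (dtSequent A) × TreeLike P × proofSize P ≤ 810 * dtSize A ^ 6 + 810
atomic-cut-proof A =
  compile d 0 ,
  (ValidFrom-map Growth1⊆AtomicCut _ (proj₁ (compile-valid d refl λ ())) , compile-last d (tree-isRule A)) ,
  compile-treeLike d 0 ,
  ≤-trans (compile-size {k = 1} {n = 0} (λ _ g → g) d)
          (tree-size-bound (dtSize A) (dtSize-pos A) (count≤ (tree A)) (seqSize-dtSequent A))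
  where
  open AtomicCutTree
  open Derivable {Growth 1} Growth0⊆Growth1 using (derivation; count≤)
  d = derivation (tree A)

cut-free-proof : ∀ A → Σ (List Line) λ P →
  IsProof CutFree P (dtSequent A) × proofSize P ≤ 810 * dtSize A ^ 6 + 810
cut-free-proof A =
  lines E , (valid E , concludes) , dag-size-bound (dtSize A) (dtSize-pos A) (size≤ E)
  where
  open CutFreeDag
  E = proj₁ (dag A [])
  concludes = proj₂ (dag A [])

proposition3p7 : Σ ℕ λ c → Σ ℕ λ k → (A : DT) →
    (Σ (List Line) λ P → IsProof AtomicCut P (Cls A ⇒ Tms A) × TreeLike P
        × proofSize P ≤ c * dtSize A ^ k + c)
    × (Σ (List Line) λ P → IsProof CutFree P (Cls A ⇒ Tms A)
        × proofSize P ≤ c * dtSize A ^ k + c)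
proposition3p7 = 810 , 6 , λ A → atomic-cut-proof A , cut-free-proof A
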